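{- Fix $l=2m+1$ with $m>0$, and let $x_1,\dots,x_m$ be indeterminates over $\mathbb{Z}/2$. For $1\le k\le m$ define $x_{l-k}:=x_k$, giving elements $x_1,\dots,x_{2m}$ of $\mathbb{Z}/2[x_1,\dots,x_m]$. For $m\ge i>j\ge1$ put $$R_{i,j}=x_i^4x_{2j}+x_j^4x_{2i}+x_{2i}x_{2j}+x_{i+j}^2x_{i-j}^2.$$ Then for every integer $r$ prime to $l$, each $R_{i,j}$ lies in the kernel of $\phi_r$.
   Context: For an integer $i$, $[i]=\sum x^{n^2}\in\mathbb{Z}/2[[x]]$ (here $x$ is the power series variable), summed over $n\in\mathbb{Z}$ with $n\equiv i\pmod l$. $S$ is the subring of $\mathbb{Z}/2[[x]]$ generated by $[1],\dots,[m]$. For $r$ prime to $l$, $\phi_r:\mathbb{Z}/2[x_1,\dots,x_m]\to S$ is the ring homomorphism sending $x_k$ to $[rk]$ for $1\le k\le m$. -}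

module Defs where

open import Data.Bool using (Bool; true; false; _xor_; _∧_; if_then_else_)
open import Data.Nat as ℕ using (ℕ; zero; suc; _∸_; _≤?_; s≤s)
open import Data.Fin using (Fin; fromℕ<)
open import Data.Integer as ℤ using (ℤ; +_; _%ℕ_)
open import Data.List using (List; map; foldr; upTo)
open import Relation.Nullary using (yes; no; does)

-- Formal power series over ℤ/2: coefficient functions (coefficient of x^N).
PS : Set
PS = ℕ → Bool

parity : List Bool → Bool
parity = foldr _xor_ false

0ₛ 1ₛ : PS
0ₛ _ = false
1ₛ zero = true
1ₛ (suc _) = false

_+ₛ_ : PS → PS → PS
(f +ₛ g) n = f n xor g n

_*ₛ_ : PS → PS → PS
(f *ₛ g) n = parity (map (λ k → f k ∧ g (n ∸ k)) (upTo (suc n)))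

lOf : ℕ → ℕ
lOf m = suc (2 ℕ.* m)

-- [i] = Σ_{n ∈ ℤ, n ≡ i mod l} x^{n²}.  The coefficient of x^N is the parity of
-- the number of integers n with n² = N and n ≡ i (mod l); every such n has
-- |n| ≤ N, so it suffices to range over n = -N, …, N.
bracket : (m : ℕ) → ℤ → PS
bracket m i N =
  parity (map (λ t → let n = (+ t) ℤ.- (+ N) in
                     does (n ℤ.* n ℤ.≟ + N) ∧ does (((n ℤ.- i) %ℕ lOf m) ℕ.≟ 0))
              (upTo (suc (2 ℕ.* N))))

-- Polynomials in ℤ/2[x_1,…,x_m], represented by ring expressions in the
-- variables var k (k : Fin m, var k standing for x_{k+1}).
data Poly (m : ℕ) : Set where
  var  : Fin m → Poly m
  zer  : Poly m
  one  : Poly m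
  _⊕_  : Poly m → Poly m → Poly m
  _⊗_  : Poly m → Poly m → Poly m

infixl 6 _⊕_
infixl 7 _⊗_

φ : (m : ℕ) → ℤ → Poly m → PS
φ m r (var k) = bracket m (r ℤ.* + suc (Data.Fin.toℕ k))
φ m r zer = 0ₛ
φ m r one = 1ₛ
φ m r (p ⊕ q) = φ m r p +ₛ φ m r q
φ m r (p ⊗ q) = φ m r p *ₛ φ m r q

-- x_k for 1 ≤ k ≤ m (junk value 0 outside this range; never used).
varOr0 : (m k : ℕ) → Poly m
varOr0 m zero = zer
varOr0 m (suc k) with suc k ≤? m
... | yes p = var (fromℕ< p)
... | no _ = zer

X : (m k : ℕ) → Poly m
X m k with k ≤? m
... | yes _ = varOr0 m k
... | no _ = varOr0 m (lOf m ∸ k)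

_^2 _^4 : ∀ {m} → Poly m → Poly m
p ^2 = p ⊗ p
p ^4 = (p ^2) ^2

R : (m i j : ℕ) → Poly m
R m i j = (X m i ^4) ⊗ X m (2 ℕ.* j) ⊕ (X m j ^4) ⊗ X m (2 ℕ.* i)
        ⊕ X m (2 ℕ.* i) ⊗ X m (2 ℕ.* j) ⊕ (X m (i ℕ.+ j) ^2) ⊗ (X m (i ∸ j) ^2)

-- Write [X] = Σ_{n ≡ X (mod l)} x^{n²} and A = ri, B = rj. Since x_{l−k} ↦ [−rk] = [rk],
-- φ_r(R_{i,j}) = [A]⁴[2B] + [B]⁴[2A] + [2A][2B] + [A+B]²[A−B]².
-- Over ℤ/2 squaring substitutes x ↦ x², so [X]^(2^e) = Σ_{n ≡ X} x^(2^e n²). As 2 is invertible mod l,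
-- each of the four products becomes a sum over the points (c, d) ≡ (2A, 2B) (mod l) with c² + d² = N,
-- weighted by [c even], [d even], 1 and [c ≡ d (mod 2)] respectively (the last via c = e + f, d = e − f).
-- At every point these weights add up to an even number.
module Submission where

open import Defs
open import Data.Nat using (ℕ; _<_; _≤_)
open import Data.Integer using (ℤ; ∣_∣)
open import Data.Nat.Coprimality using (Coprime)
open import Data.Bool using (false)
open import Relation.Binary.PropositionalEquality using (_≡_)

open import Data.Bool using (Bool; true; not; _xor_; _∧_)
open import Data.Bool.Properties as Bool
  using ( xor-∧-commutativeRing; xor-identityʳ; xor-assoc; xor-comm; xor-same; not-distribˡ-xor
        ; not-involutive; ∧-comm; ∧-zeroʳ; ∧-idem; ∧-distribʳ-xor )
open import Data.Empty using (⊥-elim)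
import Data.Fin.Properties as Fin
open import Data.Integer using (+_; -[1+_]; _⊖_; _%ℕ_; _/ℕ_)
import Data.Integer as ℤ
open import Data.Integer.Divisibility.Signed
  using (_∣_; divides; ∣-refl; ∣n⇒∣m*n; ∣m⇒∣-m; ∣m∣n⇒∣m+n; ∣m∣n⇒∣m-n)
import Data.Integer.DivMod as ℤ
import Data.Integer.Properties as ℤ
open import Data.Integer.Tactic.RingSolver using () renaming (solve-∀ to solve-ℤ)
open import Data.List using (map; upTo; applyUpTo)
open import Data.List.Properties using (map-cong)
open import Data.Nat
  using (NonZero; zero; suc; _+_; _*_; _∸_; _%_; _≟_; z≤n; s≤s; _≤′_; ≤′-reflexive; ≤′-step)
import Data.Nat.DivMod as ℕ
import Data.Nat.Properties as ℕ
open import Data.Nat.Tactic.RingSolver using () renaming (solve-∀ to solve-ℕ)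
open import Data.Product using (_×_; _,_)
open import Function.Bundles using (_⇔_; mk⇔)
open import Relation.Binary.PropositionalEquality
  using (refl; sym; trans; cong; cong₂; subst; module ≡-Reasoning)
open import Relation.Nullary using (Dec; does; yes; no)
open import Relation.Nullary.Decidable using (does-⇔; dec-false; map′; _×-dec_)
open import Algebra.Solver.Ring.AlmostCommutativeRing using (fromCommutativeRing)
-- Coefficients are normalised in Bool itself, so identities of characteristic 2 such as a + a = 0 are solved too.
open import Algebra.Solver.Ring.Simple (fromCommutativeRing xor-∧-commutativeRing) Bool._≟_
  using (solve; _:=_; _:+_; _:*_; con)

sumℕ : ℕ → (ℕ → Bool) → Bool
sumℕ zero    f = false
sumℕ (suc n) f = f 0 xor sumℕ n (λ t → f (suc t))

parity-map-applyUpTo : ∀ n (g : ℕ → ℕ) (f : ℕ → Bool) →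
                       parity (map f (applyUpTo g n)) ≡ sumℕ n (λ t → f (g t))
parity-map-applyUpTo zero    g f = refl
parity-map-applyUpTo (suc n) g f = cong (f (g 0) xor_) (parity-map-applyUpTo n (λ t → g (suc t)) f)

parity-map-upTo : ∀ n (f : ℕ → Bool) → parity (map f (upTo n)) ≡ sumℕ n f
parity-map-upTo n = parity-map-applyUpTo n (λ t → t)

sumℕ-cong : ∀ n {f g : ℕ → Bool} → (∀ t → t < n → f t ≡ g t) → sumℕ n f ≡ sumℕ n g
sumℕ-cong zero    f≗g = refl
sumℕ-cong (suc n) f≗g = cong₂ _xor_ (f≗g 0 (s≤s z≤n)) (sumℕ-cong n (λ t t<n → f≗g (suc t) (s≤s t<n)))

sumℕ-false : ∀ n → sumℕ n (λ _ → false) ≡ false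
sumℕ-false zero    = refl
sumℕ-false (suc n) = sumℕ-false n

sumℕ-xor : ∀ n (f g : ℕ → Bool) → sumℕ n (λ t → f t xor g t) ≡ sumℕ n f xor sumℕ n g
sumℕ-xor zero    f g = refl
sumℕ-xor (suc n) f g = trans (cong ((f 0 xor g 0) xor_) (sumℕ-xor n _ _)) (swap (f 0) (g 0) _ _)
  where
  swap : ∀ a b c d → (a xor b) xor (c xor d) ≡ (a xor c) xor (b xor d)
  swap = solve 4 (λ a b c d → (a :+ b) :+ (c :+ d) := (a :+ c) :+ (b :+ d)) refl

sumℕ-snoc : ∀ n (f : ℕ → Bool) → sumℕ (suc n) f ≡ sumℕ n f xor f n
sumℕ-snoc zero    f = xor-identityʳ (f 0)
sumℕ-snoc (suc n) f = trans (cong (f 0 xor_) (sumℕ-snoc n (λ t → f (suc t)))) (sym (xor-assoc (f 0) _ _))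

sumℕ-point : ∀ n x (h : ℕ → Bool) → x < n → sumℕ n (λ k → does (x ≟ k) ∧ h k) ≡ h x
sumℕ-point (suc n) zero    h _         = trans (cong (h 0 xor_) (sumℕ-false n)) (xor-identityʳ (h 0))
sumℕ-point (suc n) (suc x) h (s≤s x<n) = sumℕ-point n x (λ k → h (suc k)) x<n

sumℕ-point-outside : ∀ n x (h : ℕ → Bool) → n ≤ x → sumℕ n (λ k → does (x ≟ k) ∧ h k) ≡ false
sumℕ-point-outside zero    x       h _         = refl
sumℕ-point-outside (suc n) (suc x) h (s≤s n≤x) = sumℕ-point-outside n x (λ k → h (suc k)) n≤x

sumℕ-point-pair : ∀ n x y (b : Bool) →
                  sumℕ (suc n) (λ k → does (x ≟ k) ∧ (does (y ≟ n ∸ k) ∧ b)) ≡ does (x + y ≟ n) ∧ b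
sumℕ-point-pair n x y b with x ℕ.≤? n
... | yes x≤n = trans (sumℕ-point (suc n) x (λ k → does (y ≟ n ∸ k) ∧ b) (s≤s x≤n))
                      (cong (_∧ b) (does-⇔ (mk⇔ (λ y≡n∸x → trans (cong (λ z → x + z) y≡n∸x) (ℕ.m+[n∸m]≡n x≤n))
                                                (λ x+y≡n → trans (sym (ℕ.m+n∸m≡n x y)) (cong (_∸ x) x+y≡n)))
                                           (y ≟ n ∸ x) (x + y ≟ n)))
... | no x≰n  = trans (sumℕ-point-outside (suc n) x (λ k → does (y ≟ n ∸ k) ∧ b) (ℕ.≰⇒> x≰n))
                      (sym (cong (_∧ b) (dec-false (x + y ≟ n) λ x+y≡n → x≰n (subst (x ≤_) x+y≡n (ℕ.m≤m+n x y)))))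

Palindrome : ℕ → (ℕ → Bool) → Set
Palindrome n g = ∀ t → t ≤ n → g t ≡ g (n ∸ t)

-- The middle term g (n / 2) of g 0, …, g n when n is even, and false when n is odd.
centre : ℕ → (ℕ → Bool) → Bool
centre zero          g = g 0
centre (suc zero)    g = false
centre (suc (suc n)) g = centre n (λ t → g (suc t))

sumℕ-palindrome : ∀ n g → Palindrome n g → sumℕ (suc n) g ≡ centre n g
sumℕ-palindrome zero          g pal = xor-identityʳ (g 0)
sumℕ-palindrome (suc zero)    g pal = trans (cong (λ b → g 0 xor (b xor false)) (sym (pal 0 z≤n)))
                                            (trans (cong (g 0 xor_) (xor-identityʳ (g 0))) (xor-same (g 0)))
sumℕ-palindrome (suc (suc n)) g pal = begin
  g 0 xor sumℕ (suc (suc n)) g′            ≡⟨ cong (g 0 xor_) (sumℕ-snoc (suc n) g′) ⟩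
  g 0 xor (sumℕ (suc n) g′ xor g (2 + n))  ≡⟨ cong₂ (λ s b → g 0 xor (s xor b)) inner last≡first ⟩
  g 0 xor (centre n g′ xor g 0)            ≡⟨ cancel (g 0) (centre n g′) ⟩
  centre n g′                              ∎
  where
  open ≡-Reasoning
  g′ : ℕ → Bool
  g′ t = g (suc t)
  inner : sumℕ (suc n) g′ ≡ centre n g′
  inner = sumℕ-palindrome n g′ λ t t≤n →
    trans (pal (suc t) (s≤s (ℕ.m≤n⇒m≤1+n t≤n))) (cong g (ℕ.+-∸-assoc 1 t≤n))
  last≡first : g (2 + n) ≡ g 0
  last≡first = trans (pal (2 + n) ℕ.≤-refl) (cong g (ℕ.n∸n≡0 (2 + n)))
  cancel : ∀ a b → a xor (b xor a) ≡ b
  cancel = solve 2 (λ a b → a :+ (b :+ a) := b) refl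

double-suc : ∀ K → 2 * suc K ≡ suc (suc (2 * K))
double-suc K = cong suc (ℕ.+-suc K (K + 0))

centre-double : ∀ K g → centre (2 * K) g ≡ g K
centre-double zero    g = refl
centre-double (suc K) g = trans (cong (λ n → centre n g) (double-suc K)) (centre-double K (λ t → g (suc t)))

centre-suc-double : ∀ K g → centre (suc (2 * K)) g ≡ false
centre-suc-double zero    g = refl
centre-suc-double (suc K) g = trans (cong (λ n → centre (suc n) g) (double-suc K)) (centre-suc-double K (λ t → g (suc t)))

square-centre : ∀ (f : PS) n → (f *ₛ f) n ≡ centre n (λ k → f k ∧ f (n ∸ k))
square-centre f n = trans (parity-map-upTo (suc n) (λ k → f k ∧ f (n ∸ k))) (sumℕ-palindrome n _ λ t t≤n →
  trans (∧-comm (f t) (f (n ∸ t))) (cong (λ k → f (n ∸ t) ∧ f k) (sym (ℕ.m∸[m∸n]≡n t≤n))))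

square-double : ∀ (f : PS) K → (f *ₛ f) (2 * K) ≡ f K
square-double f K = begin
  (f *ₛ f) (2 * K)         ≡⟨ square-centre f (2 * K) ⟩
  centre (2 * K) _         ≡⟨ centre-double K _ ⟩
  f K ∧ f (2 * K ∸ K)      ≡⟨ cong (λ k → f K ∧ f k) (trans (ℕ.m+n∸m≡n K (K + 0)) (ℕ.+-identityʳ K)) ⟩
  f K ∧ f K                ≡⟨ ∧-idem (f K) ⟩
  f K                      ∎
  where open ≡-Reasoning

square-suc-double : ∀ (f : PS) K → (f *ₛ f) (suc (2 * K)) ≡ false
square-suc-double f K = trans (square-centre f (suc (2 * K))) (centre-suc-double K _)

oddℕ : ℕ → Bool
oddℕ zero    = false
oddℕ (suc n) = not (oddℕ n)

odd : ℤ → Bool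
odd (+ n)      = oddℕ n
odd -[1+ n ]   = oddℕ (suc n)

oddℕ-+ : ∀ m n → oddℕ (m + n) ≡ oddℕ m xor oddℕ n
oddℕ-+ zero    n = refl
oddℕ-+ (suc m) n = trans (cong not (oddℕ-+ m n)) (not-distribˡ-xor (oddℕ m) (oddℕ n))

odd-⊖ : ∀ m n → odd (m ⊖ n) ≡ oddℕ m xor oddℕ n
odd-⊖ zero    zero    = refl
odd-⊖ zero    (suc n) = refl
odd-⊖ (suc m) zero    = sym (xor-identityʳ (oddℕ (suc m)))
odd-⊖ (suc m) (suc n) = trans (cong odd (ℤ.[1+m]⊖[1+n]≡m⊖n m n)) (trans (odd-⊖ m n) (not-not-xor (oddℕ m) (oddℕ n)))
  where
  not-not-xor : ∀ a b → a xor b ≡ (true xor a) xor (true xor b)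
  not-not-xor = solve 2 (λ a b → a :+ b := (con true :+ a) :+ (con true :+ b)) refl

odd-+ : ∀ a b → odd (a ℤ.+ b) ≡ odd a xor odd b
odd-+ (+ m)    (+ n)    = oddℕ-+ m n
odd-+ (+ m)    -[1+ n ] = odd-⊖ m (suc n)
odd-+ -[1+ m ] (+ n)    = trans (odd-⊖ n (suc m)) (xor-comm (oddℕ n) _)
odd-+ -[1+ m ] -[1+ n ] = trans (cong (λ k → not (not k)) (oddℕ-+ m n)) (not-not-xor (oddℕ m) (oddℕ n))
  where
  not-not-xor : ∀ a b → true xor (true xor (a xor b)) ≡ (true xor a) xor (true xor b)
  not-not-xor = solve 2 (λ a b → con true :+ (con true :+ (a :+ b)) := (con true :+ a) :+ (con true :+ b)) refl

sumℤ : ℕ → (ℤ → Bool) → Bool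
sumℤ zero    f = f (+ 0)
sumℤ (suc M) f = (sumℤ M f xor f (+ suc M)) xor f -[1+ M ]

sumℤ-cong : ∀ M {f g : ℤ → Bool} → (∀ a → ∣ a ∣ ≤ M → f a ≡ g a) → sumℤ M f ≡ sumℤ M g
sumℤ-cong zero    f≗g = f≗g (+ 0) z≤n
sumℤ-cong (suc M) f≗g = cong₂ _xor_
  (cong₂ _xor_ (sumℤ-cong M (λ a a≤M → f≗g a (ℕ.m≤n⇒m≤1+n a≤M))) (f≗g (+ suc M) ℕ.≤-refl))
  (f≗g -[1+ M ] ℕ.≤-refl)

sumℤ-false : ∀ M → sumℤ M (λ _ → false) ≡ false
sumℤ-false zero    = refl
sumℤ-false (suc M) = cong (λ b → (b xor false) xor false) (sumℤ-false M)

sumℤ-xor : ∀ M (f g : ℤ → Bool) → sumℤ M (λ a → f a xor g a) ≡ sumℤ M f xor sumℤ M g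
sumℤ-xor zero    f g = refl
sumℤ-xor (suc M) f g = trans (cong (λ b → (b xor (f (+ suc M) xor g (+ suc M))) xor (f -[1+ M ] xor g -[1+ M ]))
                                   (sumℤ-xor M f g))
                             (regroup (sumℤ M f) (sumℤ M g) _ _ _ _)
  where
  regroup : ∀ s t a b c d → ((s xor t) xor (a xor b)) xor (c xor d) ≡ ((s xor a) xor c) xor ((t xor b) xor d)
  regroup = solve 6 (λ s t a b c d → ((s :+ t) :+ (a :+ b)) :+ (c :+ d) := ((s :+ a) :+ c) :+ ((t :+ b) :+ d)) refl

∧-sumℤ : ∀ M b (f : ℤ → Bool) → b ∧ sumℤ M f ≡ sumℤ M (λ a → b ∧ f a)
∧-sumℤ M true  f = refl
∧-sumℤ M false f = sym (sumℤ-false M)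

sumℤ-∧ : ∀ M b (f : ℤ → Bool) → sumℤ M f ∧ b ≡ sumℤ M (λ a → f a ∧ b)
sumℤ-∧ M b f = trans (∧-comm (sumℤ M f) b) (trans (∧-sumℤ M b f) (sumℤ-cong M (λ a _ → ∧-comm b (f a))))

sumℕ-sumℤ-comm : ∀ n M (g : ℕ → ℤ → Bool) →
                 sumℕ n (λ k → sumℤ M (g k)) ≡ sumℤ M (λ a → sumℕ n (λ k → g k a))
sumℕ-sumℤ-comm n zero    g = refl
sumℕ-sumℤ-comm n (suc M) g = begin
  sumℕ n (λ k → (sumℤ M (g k) xor g k (+ suc M)) xor g k -[1+ M ])
    ≡⟨ sumℕ-xor n _ _ ⟩
  sumℕ n (λ k → sumℤ M (g k) xor g k (+ suc M)) xor sumℕ n (λ k → g k -[1+ M ])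
    ≡⟨ cong (_xor sumℕ n (λ k → g k -[1+ M ])) (sumℕ-xor n _ _) ⟩
  (sumℕ n (λ k → sumℤ M (g k)) xor sumℕ n (λ k → g k (+ suc M))) xor sumℕ n (λ k → g k -[1+ M ])
    ≡⟨ cong (λ b → (b xor sumℕ n (λ k → g k (+ suc M))) xor sumℕ n (λ k → g k -[1+ M ])) (sumℕ-sumℤ-comm n M g) ⟩
  sumℤ (suc M) (λ a → sumℕ n (λ k → g k a)) ∎
  where open ≡-Reasoning

sumℤ-comm : ∀ M K (g : ℤ → ℤ → Bool) →
            sumℤ M (λ a → sumℤ K (g a)) ≡ sumℤ K (λ b → sumℤ M (λ a → g a b))
sumℤ-comm zero    K g = refl
sumℤ-comm (suc M) K g = begin
  (sumℤ M (λ a → sumℤ K (g a)) xor sumℤ K (g (+ suc M))) xor sumℤ K (g -[1+ M ])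
    ≡⟨ cong (λ b → (b xor sumℤ K (g (+ suc M))) xor sumℤ K (g -[1+ M ])) (sumℤ-comm M K g) ⟩
  (sumℤ K (λ b → sumℤ M (λ a → g a b)) xor sumℤ K (g (+ suc M))) xor sumℤ K (g -[1+ M ])
    ≡⟨ cong (_xor sumℤ K (g -[1+ M ])) (sym (sumℤ-xor K _ _)) ⟩
  sumℤ K (λ b → sumℤ M (λ a → g a b) xor g (+ suc M) b) xor sumℤ K (g -[1+ M ])
    ≡⟨ sym (sumℤ-xor K _ _) ⟩
  sumℤ K (λ b → sumℤ (suc M) (λ a → g a b)) ∎
  where open ≡-Reasoning

sumℤ-neg : ∀ M (f : ℤ → Bool) → sumℤ M (λ a → f (ℤ.- a)) ≡ sumℤ M f
sumℤ-neg zero    f = refl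
sumℤ-neg (suc M) f = trans (cong (λ b → (b xor f -[1+ M ]) xor f (+ suc M)) (sumℤ-neg M f))
                           (swap (sumℤ M f) _ _)
  where
  swap : ∀ s a b → (s xor a) xor b ≡ (s xor b) xor a
  swap = solve 3 (λ s a b → (s :+ a) :+ b := (s :+ b) :+ a) refl

Vanishes : ℕ → (ℤ → Bool) → Set
Vanishes M f = ∀ a → M < ∣ a ∣ → f a ≡ false

vanishes-sumℤ : ∀ {M} K {h : ℤ → ℤ → Bool} → (∀ b → Vanishes M (λ a → h a b)) → Vanishes M (λ a → sumℤ K (h a))
vanishes-sumℤ K h-vanishes a M<∣a∣ = trans (sumℤ-cong K (λ b _ → h-vanishes b a M<∣a∣)) (sumℤ-false K)

sumℤ-widen : ∀ {M K} {f : ℤ → Bool} → Vanishes M f → M ≤ K → sumℤ K f ≡ sumℤ M f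
sumℤ-widen {M} {f = f} f-vanishes M≤K = go (ℕ.≤⇒≤′ M≤K)
  where
  go : ∀ {K} → M ≤′ K → sumℤ K f ≡ sumℤ M f
  go (≤′-reflexive refl) = refl
  go (≤′-step {K} M≤′K)  = begin
    (sumℤ K f xor f (+ suc K)) xor f -[1+ K ]  ≡⟨ cong₂ (λ a b → (sumℤ K f xor a) xor b) (f-vanishes _ M<1+K) (f-vanishes _ M<1+K) ⟩
    (sumℤ K f xor false) xor false             ≡⟨ cong (_xor false) (xor-identityʳ (sumℤ K f)) ⟩
    sumℤ K f xor false                         ≡⟨ xor-identityʳ (sumℤ K f) ⟩
    sumℤ K f                                   ≡⟨ go M≤′K ⟩
    sumℤ M f                                   ∎
    where
    open ≡-Reasoning
    M<1+K : M < suc K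
    M<1+K = s≤s (ℕ.≤′⇒≤ M≤′K)

sumℤ-shift-one : ∀ K (f : ℤ → Bool) →
                 sumℤ K (λ c → f (c ℤ.+ + 1)) ≡ (sumℤ K f xor f (ℤ.- + K)) xor f (+ suc K)
sumℤ-shift-one zero    f = cong (_xor f (+ 1)) (sym (xor-same (f (+ 0))))
sumℤ-shift-one (suc K) f = begin
  (sumℤ K (λ c → f (c ℤ.+ + 1)) xor f (+ (suc K + 1))) xor f (-[1+ K ] ℤ.+ + 1)
    ≡⟨ cong₂ (λ s c → (s xor f (+ suc c)) xor f (-[1+ K ] ℤ.+ + 1)) (sumℤ-shift-one K f) (ℕ.+-comm K 1) ⟩
  (((sumℤ K f xor f (ℤ.- + K)) xor f (+ suc K)) xor f (+ suc (suc K))) xor f (-[1+ K ] ℤ.+ + 1)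
    ≡⟨ cong (λ c → (((sumℤ K f xor f (ℤ.- + K)) xor f (+ suc K)) xor f (+ suc (suc K))) xor f c) (-[1+K]+1 K) ⟩
  (((sumℤ K f xor f (ℤ.- + K)) xor f (+ suc K)) xor f (+ suc (suc K))) xor f (ℤ.- + K)
    ≡⟨ rearrange (sumℤ K f) _ _ _ _ ⟩
  (sumℤ (suc K) f xor f -[1+ K ]) xor f (+ suc (suc K)) ∎
  where
  open ≡-Reasoning
  -[1+K]+1 : ∀ K → -[1+ K ] ℤ.+ + 1 ≡ ℤ.- + K
  -[1+K]+1 zero    = refl
  -[1+K]+1 (suc K) = refl
  rearrange : ∀ s a b c d → (((s xor a) xor b) xor c) xor a ≡ (((s xor b) xor d) xor d) xor c
  rearrange = solve 5 (λ s a b c d → (((s :+ a) :+ b) :+ c) :+ a := (((s :+ b) :+ d) :+ d) :+ c) refl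

∣i∣≤∣i+n∣+n : ∀ i n → ∣ i ∣ ≤ ∣ i ℤ.+ + n ∣ + n
∣i∣≤∣i+n∣+n i n = begin
  ∣ i ∣                             ≡⟨ cong ∣_∣ (i≡[i+j]-j i (+ n)) ⟩
  ∣ (i ℤ.+ + n) ℤ.+ ℤ.- + n ∣       ≤⟨ ℤ.∣i+j∣≤∣i∣+∣j∣ (i ℤ.+ + n) (ℤ.- + n) ⟩
  ∣ i ℤ.+ + n ∣ + ∣ ℤ.- + n ∣       ≡⟨ cong (λ k → ∣ i ℤ.+ + n ∣ + k) (ℤ.∣-i∣≡∣i∣ (+ n)) ⟩
  ∣ i ℤ.+ + n ∣ + n                 ∎
  where
  open ℕ.≤-Reasoning
  i≡[i+j]-j : ∀ i j → i ≡ (i ℤ.+ j) ℤ.+ ℤ.- j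
  i≡[i+j]-j = solve-ℤ

vanishes-shift : ∀ {M} t {f : ℤ → Bool} → Vanishes M f → Vanishes (M + t) (λ c → f (c ℤ.+ + t))
vanishes-shift {M} t f-vanishes c M+t<∣c∣ =
  f-vanishes (c ℤ.+ + t) (ℕ.+-cancelʳ-< t M _ (ℕ.<-≤-trans M+t<∣c∣ (∣i∣≤∣i+n∣+n c t)))

sumℤ-shift-+ : ∀ t {M K} {f : ℤ → Bool} → Vanishes M f → M + t ≤ K →
               sumℤ K (λ c → f (c ℤ.+ + t)) ≡ sumℤ K f
sumℤ-shift-+ zero    {K = K} {f} _ _ = sumℤ-cong K (λ c _ → cong f (ℤ.+-identityʳ c))
sumℤ-shift-+ (suc t) {M} {K} {f} f-vanishes M+1+t≤K = begin
  sumℤ K (λ c → f (c ℤ.+ + suc t))                             ≡⟨ sumℤ-cong K (λ c _ → cong f (+[1+t] c)) ⟩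
  sumℤ K (λ c → g (c ℤ.+ + 1))                                  ≡⟨ sumℤ-shift-one K g ⟩
  (sumℤ K g xor g (ℤ.- + K)) xor g (+ suc K)
    ≡⟨ cong₂ (λ a b → (sumℤ K g xor a) xor b)
             (g-vanishes (ℤ.- + K) (subst (M + t <_) (sym (ℤ.∣-i∣≡∣i∣ (+ K))) M+t<K))
             (g-vanishes (+ suc K) (ℕ.m≤n⇒m≤1+n M+t<K)) ⟩
  (sumℤ K g xor false) xor false                                ≡⟨ cong (_xor false) (xor-identityʳ (sumℤ K g)) ⟩
  sumℤ K g xor false                                            ≡⟨ xor-identityʳ (sumℤ K g) ⟩
  sumℤ K g                                                      ≡⟨ sumℤ-shift-+ t f-vanishes (ℕ.<⇒≤ M+t<K) ⟩
  sumℤ K f                                                      ∎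
  where
  open ≡-Reasoning
  g : ℤ → Bool
  g c = f (c ℤ.+ + t)
  g-vanishes : Vanishes (M + t) g
  g-vanishes = vanishes-shift t f-vanishes
  M+t<K : M + t < K
  M+t<K = subst (_≤ K) (ℕ.+-suc M t) M+1+t≤K
  +[1+t] : ∀ c → c ℤ.+ + suc t ≡ (c ℤ.+ + 1) ℤ.+ + t
  +[1+t] c = trans (cong (λ k → c ℤ.+ k) (ℤ.pos-+ 1 t)) (sym (ℤ.+-assoc c (+ 1) (+ t)))

sumℤ-shift : ∀ t {M K} {f : ℤ → Bool} → Vanishes M f → M + ∣ t ∣ ≤ K →
             sumℤ K (λ c → f (c ℤ.+ t)) ≡ sumℤ K f
sumℤ-shift (+ t) f-vanishes M+t≤K = sumℤ-shift-+ t f-vanishes M+t≤K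
sumℤ-shift -[1+ t ] {M} {K} {f} f-vanishes M+t≤K = begin
  sumℤ K (λ c → f (c ℤ.+ -[1+ t ]))             ≡⟨ sym (sumℤ-neg K _) ⟩
  sumℤ K (λ c → f (ℤ.- c ℤ.+ -[1+ t ]))         ≡⟨ sumℤ-cong K (λ c _ → cong f (sym (ℤ.neg-distrib-+ c (+ suc t)))) ⟩
  sumℤ K (λ c → f (ℤ.- (c ℤ.+ + suc t)))        ≡⟨ sumℤ-shift-+ (suc t) f∘neg-vanishes M+t≤K ⟩
  sumℤ K (λ c → f (ℤ.- c))                      ≡⟨ sumℤ-neg K f ⟩
  sumℤ K f                                      ∎
  where
  open ≡-Reasoning
  f∘neg-vanishes : Vanishes M (λ c → f (ℤ.- c))
  f∘neg-vanishes c M<∣c∣ = f-vanishes (ℤ.- c) (subst (M <_) (sym (ℤ.∣-i∣≡∣i∣ c)) M<∣c∣)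

oddℕ-double : ∀ K → oddℕ (2 * K) ≡ false
oddℕ-double zero    = refl
oddℕ-double (suc K) = trans (cong oddℕ (double-suc K)) (trans (not-involutive _) (oddℕ-double K))

sumℤ-double : ∀ M (g : ℤ → Bool) → sumℤ M (λ a → g (+ 2 ℤ.* a)) ≡ sumℤ (2 * M) (λ c → not (odd c) ∧ g c)
sumℤ-double zero    g = refl
sumℤ-double (suc M) g = begin
  (sumℤ M (λ a → g (+ 2 ℤ.* a)) xor g (+ 2 ℤ.* + suc M)) xor g (+ 2 ℤ.* -[1+ M ])
    ≡⟨ cong₂ (λ s c → (s xor g c) xor g (+ 2 ℤ.* -[1+ M ])) (sumℤ-double M g) 2*[1+M] ⟩
  (sumℤ D h xor g (+ suc (suc D))) xor g (+ 2 ℤ.* -[1+ M ])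
    ≡⟨ cong (λ c → (sumℤ D h xor g (+ suc (suc D))) xor g c) 2*-[1+M] ⟩
  (sumℤ D h xor g (+ suc (suc D))) xor g -[1+ suc D ]
    ≡⟨ cong (λ s → (s xor g (+ suc (suc D))) xor g -[1+ suc D ])
            (sym (trans (cong (_xor false) (xor-identityʳ (sumℤ D h))) (xor-identityʳ (sumℤ D h)))) ⟩
  (((sumℤ D h xor false) xor false) xor g (+ suc (suc D))) xor g -[1+ suc D ]
    -- the new terms at ±(D + 1) have weight 0 and those at ±(D + 2) have weight 1
    ≡⟨ cong (λ p → (((sumℤ D h xor (not (not p) ∧ g (+ suc D))) xor (not (not p) ∧ g -[1+ D ]))
                    xor (not (not (not p)) ∧ g (+ suc (suc D)))) xor (not (not (not p)) ∧ g -[1+ suc D ]))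
            (sym (oddℕ-double M)) ⟩
  sumℤ (suc (suc D)) h
    ≡⟨ cong (λ n → sumℤ n h) (sym (double-suc M)) ⟩
  sumℤ (2 * suc M) h ∎
  where
  open ≡-Reasoning
  D : ℕ
  D = 2 * M
  h : ℤ → Bool
  h c = not (odd c) ∧ g c
  2*[1+M] : + 2 ℤ.* + suc M ≡ + suc (suc D)
  2*[1+M] = trans (sym (ℤ.pos-* 2 (suc M))) (cong +_ (double-suc M))
  2*-[1+M] : + 2 ℤ.* -[1+ M ] ≡ -[1+ suc D ]
  2*-[1+M] = cong -[1+_] (ℕ.+-suc M (M + 0))

sumℤ-double-within : ∀ n {g : ℤ → Bool} → Vanishes n g →
                     sumℤ n (λ a → g (+ 2 ℤ.* a)) ≡ sumℤ n (λ c → not (odd c) ∧ g c)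
sumℤ-double-within n {g} g-vanishes = trans (sumℤ-double n g)
  (sumℤ-widen (λ c n<∣c∣ → trans (cong (not (odd c) ∧_) (g-vanishes c n<∣c∣)) (∧-zeroʳ (not (odd c))))
              (ℕ.m≤m+n n (n + 0)))

sumℕ-centred : ∀ M (f : ℤ → Bool) → sumℕ (suc (2 * M)) (λ t → f (+ t ℤ.- + M)) ≡ sumℤ M f
sumℕ-centred zero    f = xor-identityʳ (f (+ 0))
sumℕ-centred (suc M) f = begin
  sumℕ (suc (2 * suc M)) F                                  ≡⟨ cong (λ n → sumℕ (suc n) F) (double-suc M) ⟩
  F 0 xor sumℕ (suc (suc (2 * M))) (λ t → F (suc t))        ≡⟨ cong (F 0 xor_) (sumℕ-snoc (suc (2 * M)) (λ t → F (suc t))) ⟩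
  F 0 xor (sumℕ (suc (2 * M)) (λ t → F (suc t)) xor F (suc (suc (2 * M))))
    ≡⟨ cong₂ (λ s b → F 0 xor (s xor f b))
             (trans (sumℕ-cong (suc (2 * M)) (λ t _ → cong f (shift t))) (sumℕ-centred M f)) top ⟩
  f -[1+ M ] xor (sumℤ M f xor f (+ suc M))                 ≡⟨ xor-comm (f -[1+ M ]) _ ⟩
  sumℤ (suc M) f                                            ∎
  where
  open ≡-Reasoning
  F : ℕ → Bool
  F t = f (+ t ℤ.- + suc M)
  shift : ∀ t → + suc t ℤ.- + suc M ≡ + t ℤ.- + M
  shift t = trans (ℤ.[+m]-[+n]≡m⊖n (suc t) (suc M))
           (trans (ℤ.[1+m]⊖[1+n]≡m⊖n t M) (sym (ℤ.[+m]-[+n]≡m⊖n t M)))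
  top : + suc (suc (2 * M)) ℤ.- + suc M ≡ + suc M
  top = begin
    + suc (suc (2 * M)) ℤ.- + suc M  ≡⟨ cong (λ n → + n ℤ.- + suc M) (2+2M≡[1+M]+[1+M] M) ⟩
    + (suc M + suc M) ℤ.- + suc M    ≡⟨ cong (ℤ._- + suc M) (ℤ.pos-+ (suc M) (suc M)) ⟩
    (+ suc M ℤ.+ + suc M) ℤ.- + suc M ≡⟨ [a+b]-b≡a (+ suc M) (+ suc M) ⟩
    + suc M                           ∎
    where
    2+2M≡[1+M]+[1+M] : ∀ M → 2 + 2 * M ≡ suc M + suc M
    2+2M≡[1+M]+[1+M] = solve-ℕ
    [a+b]-b≡a : ∀ a b → (a ℤ.+ b) ℤ.- b ≡ a
    [a+b]-b≡a = solve-ℤ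

does-≟-< : ∀ {x k} → k < x → does (x ≟ k) ≡ false
does-≟-< k<x = dec-false (_ ≟ _) λ x≡k → ℕ.<-irrefl (sym x≡k) k<x

sq : ℤ → ℕ
sq a = ∣ a ∣ * ∣ a ∣

∣a∣≤sq : ∀ a → ∣ a ∣ ≤ sq a
∣a∣≤sq a with ∣ a ∣
... | zero  = z≤n
... | suc n = ℕ.m≤m*n (suc n) (suc n)

sq≡a*a : ∀ a → + sq a ≡ a ℤ.* a
sq≡a*a (+ n)    = ℤ.pos-* n n
sq≡a*a -[1+ n ] = refl

sq-double : ∀ a → sq (+ 2 ℤ.* a) ≡ 4 * sq a
sq-double a = trans (cong (λ k → k * k) (ℤ.abs-* (+ 2) a)) ([2x]²≡4x² ∣ a ∣)
  where
  [2x]²≡4x² : ∀ x → (2 * x) * (2 * x) ≡ 4 * (x * x)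
  [2x]²≡4x² = solve-ℕ

sq-rotate : ∀ e f → sq (e ℤ.+ f) + sq (e ℤ.- f) ≡ 2 * sq e + 2 * sq f
sq-rotate e f = ℤ.+-injective (begin
  + (sq (e ℤ.+ f) + sq (e ℤ.- f))                   ≡⟨ ℤ.pos-+ (sq (e ℤ.+ f)) (sq (e ℤ.- f)) ⟩
  + sq (e ℤ.+ f) ℤ.+ + sq (e ℤ.- f)                 ≡⟨ cong₂ ℤ._+_ (sq≡a*a (e ℤ.+ f)) (sq≡a*a (e ℤ.- f)) ⟩
  (e ℤ.+ f) ℤ.* (e ℤ.+ f) ℤ.+ (e ℤ.- f) ℤ.* (e ℤ.- f) ≡⟨ parallelogram e f ⟩
  + 2 ℤ.* (e ℤ.* e) ℤ.+ + 2 ℤ.* (f ℤ.* f)           ≡⟨ cong₂ (λ x y → + 2 ℤ.* x ℤ.+ + 2 ℤ.* y) (sym (sq≡a*a e)) (sym (sq≡a*a f)) ⟩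
  + 2 ℤ.* + sq e ℤ.+ + 2 ℤ.* + sq f                 ≡⟨ cong₂ ℤ._+_ (sym (ℤ.pos-* 2 (sq e))) (sym (ℤ.pos-* 2 (sq f))) ⟩
  + (2 * sq e) ℤ.+ + (2 * sq f)                     ≡⟨ sym (ℤ.pos-+ (2 * sq e) (2 * sq f)) ⟩
  + (2 * sq e + 2 * sq f)                           ∎)
  where
  open ≡-Reasoning
  parallelogram : ∀ e f → (e ℤ.+ f) ℤ.* (e ℤ.+ f) ℤ.+ (e ℤ.- f) ℤ.* (e ℤ.- f) ≡ + 2 ℤ.* (e ℤ.* e) ℤ.+ + 2 ℤ.* (f ℤ.* f)
  parallelogram = solve-ℤ

-- Coefficient k of Σ_a F(a) x^{w a²}; only |a| ≤ k can contribute.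
θ : ℕ → (ℤ → Bool) → PS
θ w F k = sumℤ k (λ a → does (w * sq a ≟ k) ∧ F a)

θ-summand-vanishes : ∀ w .{{_ : NonZero w}} (F : ℤ → Bool) k → Vanishes k (λ a → does (w * sq a ≟ k) ∧ F a)
θ-summand-vanishes w F k a k<∣a∣ =
  cong (_∧ F a) (does-≟-< (ℕ.<-≤-trans k<∣a∣ (ℕ.≤-trans (∣a∣≤sq a) (ℕ.m≤n*m (sq a) w))))

θ-widen : ∀ w .{{_ : NonZero w}} (F : ℤ → Bool) {k M} → k ≤ M →
          θ w F k ≡ sumℤ M (λ a → does (w * sq a ≟ k) ∧ F a)
θ-widen w F {k} k≤M = sym (sumℤ-widen (θ-summand-vanishes w F k) k≤M)

data Half : ℕ → Set where
  double     : ∀ K → Half (2 * K)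
  suc-double : ∀ K → Half (suc (2 * K))

half : ∀ n → Half n
half zero    = double 0
half (suc n) with half n
... | double K     = suc-double K
... | suc-double K = subst Half (double-suc K) (double (suc K))

θ-square : ∀ w .{{_ : NonZero w}} (F : ℤ → Bool) n → (θ w F *ₛ θ w F) n ≡ θ (2 * w) F n
θ-square w F n with half n
... | double K = begin
  (θ w F *ₛ θ w F) (2 * K)                                  ≡⟨ square-double (θ w F) K ⟩
  θ w F K                                                   ≡⟨ θ-widen w F (ℕ.m≤m+n K (K + 0)) ⟩
  sumℤ (2 * K) (λ a → does (w * sq a ≟ K) ∧ F a)            ≡⟨ sumℤ-cong (2 * K) (λ a _ → cong (_∧ F a) (does-⇔ (double⇔ a) (w * sq a ≟ K) (2 * w * sq a ≟ 2 * K))) ⟩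
  θ (2 * w) F (2 * K)                                       ∎
  where
  open ≡-Reasoning
  double⇔ : ∀ a → w * sq a ≡ K ⇔ 2 * w * sq a ≡ 2 * K
  double⇔ a = mk⇔ (λ eq → trans (ℕ.*-assoc 2 w (sq a)) (cong (2 *_) eq))
                  (λ eq → ℕ.*-cancelˡ-≡ (w * sq a) K 2 (trans (sym (ℕ.*-assoc 2 w (sq a))) eq))
... | suc-double K = begin
  (θ w F *ₛ θ w F) (suc (2 * K))    ≡⟨ square-suc-double (θ w F) K ⟩
  false                             ≡⟨ sumℤ-false (suc (2 * K)) ⟨
  sumℤ (suc (2 * K)) (λ _ → false)  ≡⟨ sumℤ-cong (suc (2 * K)) (λ a _ → cong (_∧ F a) (not-odd a)) ⟨
  θ (2 * w) F (suc (2 * K))         ∎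
  where
  open ≡-Reasoning
  not-odd : ∀ a → does (2 * w * sq a ≟ suc (2 * K)) ≡ false
  not-odd a = dec-false (2 * w * sq a ≟ suc (2 * K)) λ eq →
    ℕ.even≢odd (w * sq a) K (trans (sym (ℕ.*-assoc 2 w (sq a))) eq)

θ-product : ∀ w₁ w₂ .{{_ : NonZero w₁}} .{{_ : NonZero w₂}} (F G : ℤ → Bool) n →
            (θ w₁ F *ₛ θ w₂ G) n ≡
            sumℤ n (λ a → sumℤ n (λ b → does (w₁ * sq a + w₂ * sq b ≟ n) ∧ (F a ∧ G b)))
θ-product w₁ w₂ F G n = begin
  (θ w₁ F *ₛ θ w₂ G) n
    ≡⟨ parity-map-upTo (suc n) (λ k → θ w₁ F k ∧ θ w₂ G (n ∸ k)) ⟩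
  sumℕ (suc n) (λ k → θ w₁ F k ∧ θ w₂ G (n ∸ k))
    ≡⟨ sumℕ-cong (suc n) (λ k k<1+n → cong₂ _∧_ (θ-widen w₁ F (ℕ.≤-pred k<1+n)) (θ-widen w₂ G (ℕ.m∸n≤m n k))) ⟩
  sumℕ (suc n) (λ k → sumℤ n (P₁ k) ∧ sumℤ n (P₂ (n ∸ k)))
    ≡⟨ sumℕ-cong (suc n) (λ k _ → trans (sumℤ-∧ n _ (P₁ k)) (sumℤ-cong n (λ a _ → ∧-sumℤ n (P₁ k a) (P₂ (n ∸ k))))) ⟩
  sumℕ (suc n) (λ k → sumℤ n (λ a → sumℤ n (λ b → P₁ k a ∧ P₂ (n ∸ k) b)))
    ≡⟨ sumℕ-sumℤ-comm (suc n) n (λ k a → sumℤ n (λ b → P₁ k a ∧ P₂ (n ∸ k) b)) ⟩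
  sumℤ n (λ a → sumℕ (suc n) (λ k → sumℤ n (λ b → P₁ k a ∧ P₂ (n ∸ k) b)))
    ≡⟨ sumℤ-cong n (λ a _ → sumℕ-sumℤ-comm (suc n) n (λ k b → P₁ k a ∧ P₂ (n ∸ k) b)) ⟩
  sumℤ n (λ a → sumℤ n (λ b → sumℕ (suc n) (λ k → P₁ k a ∧ P₂ (n ∸ k) b)))
    ≡⟨ sumℤ-cong n (λ a _ → sumℤ-cong n (λ b _ → point a b)) ⟩
  sumℤ n (λ a → sumℤ n (λ b → does (w₁ * sq a + w₂ * sq b ≟ n) ∧ (F a ∧ G b))) ∎
  where
  open ≡-Reasoning
  P₁ : ℕ → ℤ → Bool
  P₁ k a = does (w₁ * sq a ≟ k) ∧ F a
  P₂ : ℕ → ℤ → Bool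
  P₂ k b = does (w₂ * sq b ≟ k) ∧ G b
  regroup : ∀ p f q g → (p ∧ f) ∧ (q ∧ g) ≡ p ∧ (q ∧ (f ∧ g))
  regroup = solve 4 (λ p f q g → (p :* f) :* (q :* g) := p :* (q :* (f :* g))) refl
  point : ∀ a b → sumℕ (suc n) (λ k → P₁ k a ∧ P₂ (n ∸ k) b) ≡ does (w₁ * sq a + w₂ * sq b ≟ n) ∧ (F a ∧ G b)
  point a b = trans (sumℕ-cong (suc n) (λ k _ → regroup (does (w₁ * sq a ≟ k)) (F a) (does (w₂ * sq b ≟ n ∸ k)) (G b)))
                    (sumℕ-point-pair n (w₁ * sq a) (w₂ * sq b) (F a ∧ G b))

*ₛ-cong : ∀ {f f′ g g′ : PS} → (∀ k → f k ≡ f′ k) → (∀ k → g k ≡ g′ k) → ∀ n → (f *ₛ g) n ≡ (f′ *ₛ g′) n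
*ₛ-cong f≗f′ g≗g′ n = cong parity (map-cong (λ k → cong₂ _∧_ (f≗f′ k) (g≗g′ (n ∸ k))) (upTo (suc n)))

θ-square-cong : ∀ w .{{_ : NonZero w}} (F : ℤ → Bool) {f : PS} → (∀ k → f k ≡ θ w F k) →
                ∀ k → (f *ₛ f) k ≡ θ (2 * w) F k
θ-square-cong w F f≗θ k = trans (*ₛ-cong f≗θ f≗θ k) (θ-square w F k)

module Residues (m : ℕ) where

  l : ℕ
  l = lOf m

  infix 4 l∣_
  l∣_ : ℤ → Set
  l∣ x = + l ∣ x

  inClass : ℤ → ℤ → Bool
  inClass X n = does (((n ℤ.- X) %ℕ l) ≟ 0)

  %ℕ≡0⇒∣ : ∀ x → x %ℕ l ≡ 0 → l∣ x
  %ℕ≡0⇒∣ x x%l≡0 = divides (x /ℕ l) (begin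
    x                                   ≡⟨ ℤ.a≡a%ℕn+[a/ℕn]*n x l ⟩
    + (x %ℕ l) ℤ.+ (x /ℕ l) ℤ.* + l      ≡⟨ cong (λ r → + r ℤ.+ (x /ℕ l) ℤ.* + l) x%l≡0 ⟩
    + 0 ℤ.+ (x /ℕ l) ℤ.* + l             ≡⟨ ℤ.+-identityˡ _ ⟩
    (x /ℕ l) ℤ.* + l                     ∎)
    where open ≡-Reasoning

  ∣⇒%ℕ≡0 : ∀ x → l∣ x → x %ℕ l ≡ 0
  ∣⇒%ℕ≡0 x (divides q refl) = from-abs (q ℤ.* + l) (trans (cong (_% l) (ℤ.abs-* q (+ l))) (ℕ.m*n%n≡0 ∣ q ∣ l))
    where
    from-abs : ∀ x → ∣ x ∣ % l ≡ 0 → x %ℕ l ≡ 0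
    from-abs (+ n)    ∣x∣%l≡0 = ∣x∣%l≡0
    from-abs -[1+ n ] ∣x∣%l≡0 with suc n % l
    ... | zero = refl
    from-abs -[1+ n ] () | suc _

  l∣? : ∀ x → Dec (l∣ x)
  l∣? x = map′ (%ℕ≡0⇒∣ x) (∣⇒%ℕ≡0 x) (x %ℕ l ≟ 0)

  inClass-cong : ∀ X n Y p → (l∣ n ℤ.- X ⇔ l∣ p ℤ.- Y) → inClass X n ≡ inClass Y p
  inClass-cong X n Y p equiv = does-⇔ equiv (l∣? (n ℤ.- X)) (l∣? (p ℤ.- Y))

  l∣2*⇒l∣ : ∀ x → l∣ + 2 ℤ.* x → l∣ x
  l∣2*⇒l∣ x l∣2x = subst l∣_ (sym x≡[1+m]2x-xl)
    (∣m∣n⇒∣m-n (∣n⇒∣m*n (+ 1 ℤ.+ + m) l∣2x) (∣n⇒∣m*n x ∣-refl))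
    where
    x≡[1+m]2x-x[1+2m] : ∀ x m → x ≡ (+ 1 ℤ.+ m) ℤ.* (+ 2 ℤ.* x) ℤ.- x ℤ.* (+ 1 ℤ.+ + 2 ℤ.* m)
    x≡[1+m]2x-x[1+2m] = solve-ℤ
    l≡1+2m : + l ≡ + 1 ℤ.+ + 2 ℤ.* + m
    l≡1+2m = trans (ℤ.pos-+ 1 (2 * m)) (cong (λ z → + 1 ℤ.+ z) (ℤ.pos-* 2 m))
    x≡[1+m]2x-xl : x ≡ (+ 1 ℤ.+ + m) ℤ.* (+ 2 ℤ.* x) ℤ.- x ℤ.* + l
    x≡[1+m]2x-xl = trans (x≡[1+m]2x-x[1+2m] x (+ m))
                         (cong (λ L → (+ 1 ℤ.+ + m) ℤ.* (+ 2 ℤ.* x) ℤ.- x ℤ.* L) (sym l≡1+2m))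

  inClass-double : ∀ X a → inClass (+ 2 ℤ.* X) (+ 2 ℤ.* a) ≡ inClass X a
  inClass-double X a = inClass-cong (+ 2 ℤ.* X) (+ 2 ℤ.* a) X a (mk⇔
    (λ l∣2a-2X → l∣2*⇒l∣ (a ℤ.- X) (subst l∣_ (2a-2X≡2[a-X] a X) l∣2a-2X))
    (λ l∣a-X → subst l∣_ (sym (2a-2X≡2[a-X] a X)) (∣n⇒∣m*n (+ 2) l∣a-X)))
    where
    2a-2X≡2[a-X] : ∀ a X → + 2 ℤ.* a ℤ.- + 2 ℤ.* X ≡ + 2 ℤ.* (a ℤ.- X)
    2a-2X≡2[a-X] = solve-ℤ

  inClass-neg : ∀ {B B'} → l∣ B ℤ.+ B' → ∀ a → inClass B' (ℤ.- a) ≡ inClass B a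
  inClass-neg {B} {B'} l∣B+B' a = inClass-cong B' (ℤ.- a) B a (mk⇔
    (λ l∣-a-B' → subst l∣_ (sym (reflect₁ a B B')) (∣m∣n⇒∣m-n (∣m⇒∣-m l∣-a-B') l∣B+B'))
    (λ l∣a-B → subst l∣_ (sym (reflect₂ a B B')) (∣m∣n⇒∣m-n (∣m⇒∣-m l∣a-B) l∣B+B')))
    where
    reflect₁ : ∀ a B B' → a ℤ.- B ≡ ℤ.- (ℤ.- a ℤ.- B') ℤ.- (B ℤ.+ B')
    reflect₁ = solve-ℤ
    reflect₂ : ∀ a B B' → ℤ.- a ℤ.- B' ≡ ℤ.- (a ℤ.- B) ℤ.- (B ℤ.+ B')
    reflect₂ = solve-ℤ

  -- The converse direction divides by 2, which is invertible mod l.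
  inClass-rotate : ∀ A B e f →
    inClass (A ℤ.+ B) e ∧ inClass (A ℤ.- B) f ≡ inClass (+ 2 ℤ.* A) (e ℤ.+ f) ∧ inClass (+ 2 ℤ.* B) (e ℤ.- f)
  inClass-rotate A B e f = does-⇔ (mk⇔ forth back)
    (l∣? (e ℤ.- (A ℤ.+ B)) ×-dec l∣? (f ℤ.- (A ℤ.- B)))
    (l∣? ((e ℤ.+ f) ℤ.- + 2 ℤ.* A) ×-dec l∣? ((e ℤ.- f) ℤ.- + 2 ℤ.* B))
    where
    sum-diff : ∀ e f A B → (e ℤ.+ f) ℤ.- + 2 ℤ.* A ≡ (e ℤ.- (A ℤ.+ B)) ℤ.+ (f ℤ.- (A ℤ.- B))
    sum-diff = solve-ℤ
    diff-diff : ∀ e f A B → (e ℤ.- f) ℤ.- + 2 ℤ.* B ≡ (e ℤ.- (A ℤ.+ B)) ℤ.- (f ℤ.- (A ℤ.- B))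
    diff-diff = solve-ℤ
    twice-first : ∀ e f A B → ((e ℤ.+ f) ℤ.- + 2 ℤ.* A) ℤ.+ ((e ℤ.- f) ℤ.- + 2 ℤ.* B) ≡ + 2 ℤ.* (e ℤ.- (A ℤ.+ B))
    twice-first = solve-ℤ
    twice-second : ∀ e f A B → ((e ℤ.+ f) ℤ.- + 2 ℤ.* A) ℤ.- ((e ℤ.- f) ℤ.- + 2 ℤ.* B) ≡ + 2 ℤ.* (f ℤ.- (A ℤ.- B))
    twice-second = solve-ℤ
    forth : l∣ e ℤ.- (A ℤ.+ B) × l∣ f ℤ.- (A ℤ.- B) → l∣ (e ℤ.+ f) ℤ.- + 2 ℤ.* A × l∣ (e ℤ.- f) ℤ.- + 2 ℤ.* B
    forth (u , v) = subst l∣_ (sym (sum-diff e f A B)) (∣m∣n⇒∣m+n u v)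
                  , subst l∣_ (sym (diff-diff e f A B)) (∣m∣n⇒∣m-n u v)
    back : l∣ (e ℤ.+ f) ℤ.- + 2 ℤ.* A × l∣ (e ℤ.- f) ℤ.- + 2 ℤ.* B → l∣ e ℤ.- (A ℤ.+ B) × l∣ f ℤ.- (A ℤ.- B)
    back (u , v) = l∣2*⇒l∣ _ (subst l∣_ (twice-first e f A B) (∣m∣n⇒∣m+n u v))
                 , l∣2*⇒l∣ _ (subst l∣_ (twice-second e f A B) (∣m∣n⇒∣m-n u v))

  bracket≡θ : ∀ X N → bracket m X N ≡ θ 1 (inClass X) N
  bracket≡θ X N = begin
    bracket m X N
      ≡⟨ parity-map-upTo (suc (2 * N)) (λ t → let a = + t ℤ.- + N in does (a ℤ.* a ℤ.≟ + N) ∧ inClass X a) ⟩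
    sumℕ (suc (2 * N)) (λ t → let a = + t ℤ.- + N in does (a ℤ.* a ℤ.≟ + N) ∧ inClass X a)
      ≡⟨ sumℕ-centred N (λ a → does (a ℤ.* a ℤ.≟ + N) ∧ inClass X a) ⟩
    sumℤ N (λ a → does (a ℤ.* a ℤ.≟ + N) ∧ inClass X a)
      ≡⟨ sumℤ-cong N (λ a _ → cong (_∧ inClass X a) (does-⇔ (square⇔ a) (a ℤ.* a ℤ.≟ + N) (1 * sq a ≟ N))) ⟩
    θ 1 (inClass X) N ∎
    where
    open ≡-Reasoning
    square⇔ : ∀ a → a ℤ.* a ≡ + N ⇔ 1 * sq a ≡ N
    square⇔ a = mk⇔ (λ eq → trans (ℕ.*-identityˡ (sq a)) (ℤ.+-injective (trans (sq≡a*a a) eq)))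
                    (λ eq → trans (sym (sq≡a*a a)) (cong +_ (trans (sym (ℕ.*-identityˡ (sq a))) eq)))

  θ-reflect : ∀ {B B'} → l∣ B ℤ.+ B' → ∀ n → θ 1 (inClass B) n ≡ θ 1 (inClass B') n
  θ-reflect {B} {B'} l∣B+B' n = begin
    sumℤ n (λ a → does (1 * sq a ≟ n) ∧ inClass B a)
      ≡⟨ sumℤ-cong n (λ a _ → sym (cong₂ (λ s b → does (1 * s ≟ n) ∧ b)
                                         (cong (λ k → k * k) (ℤ.∣-i∣≡∣i∣ a)) (inClass-neg l∣B+B' a))) ⟩
    sumℤ n (λ a → does (1 * sq (ℤ.- a) ≟ n) ∧ inClass B' (ℤ.- a))
      ≡⟨ sumℤ-neg n (λ a → does (1 * sq a ≟ n) ∧ inClass B' a) ⟩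
    sumℤ n (λ a → does (1 * sq a ≟ n) ∧ inClass B' a) ∎
    where open ≡-Reasoning

  φ-varOr0 : ∀ r k → 1 ≤ k → k ≤ m → φ m r (varOr0 m k) ≡ bracket m (r ℤ.* + k)
  φ-varOr0 r (suc k) _ k<m with suc k ℕ.≤? m
  ... | yes k<m′ = cong (λ i → bracket m (r ℤ.* + suc i)) (Fin.toℕ-fromℕ< k<m′)
  ... | no  k≮m  = ⊥-elim (k≮m k<m)

  φ-X : ∀ r k → 1 ≤ k → k ≤ 2 * m → ∀ n → φ m r (X m k) n ≡ θ 1 (inClass (r ℤ.* + k)) n
  φ-X r k 1≤k k≤2m n with k ℕ.≤? m
  ... | yes k≤m = trans (cong (λ f → f n) (φ-varOr0 r k 1≤k k≤m)) (bracket≡θ _ n)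
  ... | no  k≰m = trans (cong (λ f → f n) (φ-varOr0 r (l ∸ k) (ℕ.m<n⇒0<n∸m k<l) l-k≤m))
                 (trans (bracket≡θ _ n) (θ-reflect l∣r[l-k]+rk n))
    where
    k<l : k < l
    k<l = s≤s k≤2m
    l-k≤m : l ∸ k ≤ m
    l-k≤m = ℕ.≤-trans (ℕ.∸-monoʳ-≤ l (ℕ.≰⇒> k≰m)) (ℕ.≤-reflexive (trans (ℕ.m+n∸m≡n m (m + 0)) (ℕ.+-identityʳ m)))
    r[l-k]+rk≡r*l : r ℤ.* + (l ∸ k) ℤ.+ r ℤ.* + k ≡ r ℤ.* + l
    r[l-k]+rk≡r*l = trans (sym (ℤ.*-distribˡ-+ r (+ (l ∸ k)) (+ k)))
                          (cong (λ i → r ℤ.* i) (trans (sym (ℤ.pos-+ (l ∸ k) k)) (cong +_ (ℕ.m∸n+n≡m (ℕ.<⇒≤ k<l)))))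
    l∣r[l-k]+rk : l∣ r ℤ.* + (l ∸ k) ℤ.+ r ℤ.* + k
    l∣r[l-k]+rk = subst l∣_ (sym r[l-k]+rk≡r*l) (∣n⇒∣m*n r ∣-refl)

  -- φ_r(R_{i,j}) in terms of A = ri and B = rj.
  θ-combination : ℤ → ℤ → PS
  θ-combination A B =
    (((θ 4 (inClass A) *ₛ θ 1 (inClass (+ 2 ℤ.* B))) +ₛ (θ 4 (inClass B) *ₛ θ 1 (inClass (+ 2 ℤ.* A))))
      +ₛ (θ 1 (inClass (+ 2 ℤ.* A)) *ₛ θ 1 (inClass (+ 2 ℤ.* B))))
      +ₛ (θ 2 (inClass (A ℤ.+ B)) *ₛ θ 2 (inClass (A ℤ.- B)))

  module _ (A B : ℤ) (n : ℕ) where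

    onCircle : ℤ → ℤ → Bool
    onCircle c d = does (sq c + sq d ≟ n) ∧ (inClass (+ 2 ℤ.* A) c ∧ inClass (+ 2 ℤ.* B) d)

    onCircle-vanishesˡ : ∀ d → Vanishes n (λ c → onCircle c d)
    onCircle-vanishesˡ d c n<∣c∣ =
      cong (_∧ (inClass (+ 2 ℤ.* A) c ∧ inClass (+ 2 ℤ.* B) d))
           (does-≟-< (ℕ.<-≤-trans n<∣c∣ (ℕ.≤-trans (∣a∣≤sq c) (ℕ.m≤m+n (sq c) (sq d)))))

    onCircle-vanishesʳ : ∀ c → Vanishes n (onCircle c)
    onCircle-vanishesʳ c d n<∣d∣ =
      cong (_∧ (inClass (+ 2 ℤ.* A) c ∧ inClass (+ 2 ℤ.* B) d))
           (does-≟-< (ℕ.<-≤-trans n<∣d∣ (ℕ.≤-trans (∣a∣≤sq d) (ℕ.m≤n+m (sq d) (sq c)))))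

    count : (ℤ → ℤ → Bool) → Bool
    count w = sumℤ n (λ c → sumℤ n (λ d → w c d ∧ onCircle c d))

    count-xor : ∀ w w′ → count w xor count w′ ≡ count (λ c d → w c d xor w′ c d)
    count-xor w w′ = sym (trans
      (sumℤ-cong n (λ c _ → trans (sumℤ-cong n (λ d _ → ∧-distribʳ-xor (onCircle c d) (w c d) (w′ c d)))
                                  (sumℤ-xor n _ _)))
      (sumℤ-xor n _ _))

    count-false : ∀ w → (∀ c d → w c d ≡ false) → count w ≡ false
    count-false w w≡false = trans
      (sumℤ-cong n (λ c _ → trans (sumℤ-cong n (λ d _ → cong (_∧ onCircle c d) (w≡false c d))) (sumℤ-false n)))
      (sumℤ-false n)

    quartic-term : (θ 4 (inClass A) *ₛ θ 1 (inClass (+ 2 ℤ.* B))) n ≡ count (λ c _ → not (odd c))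
    quartic-term = begin
      (θ 4 (inClass A) *ₛ θ 1 (inClass (+ 2 ℤ.* B))) n
        ≡⟨ θ-product 4 1 (inClass A) (inClass (+ 2 ℤ.* B)) n ⟩
      sumℤ n (λ a → sumℤ n (λ b → does (4 * sq a + 1 * sq b ≟ n) ∧ (inClass A a ∧ inClass (+ 2 ℤ.* B) b)))
        ≡⟨ sumℤ-cong n (λ a _ → sumℤ-cong n (λ b _ → point a b)) ⟩
      sumℤ n (λ a → sumℤ n (λ b → onCircle (+ 2 ℤ.* a) b))
        ≡⟨ sumℤ-double-within n (vanishes-sumℤ n onCircle-vanishesˡ) ⟩
      sumℤ n (λ c → not (odd c) ∧ sumℤ n (onCircle c))
        ≡⟨ sumℤ-cong n (λ c _ → ∧-sumℤ n (not (odd c)) (onCircle c)) ⟩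
      count (λ c _ → not (odd c)) ∎
      where
      open ≡-Reasoning
      point : ∀ a b → does (4 * sq a + 1 * sq b ≟ n) ∧ (inClass A a ∧ inClass (+ 2 ℤ.* B) b) ≡ onCircle (+ 2 ℤ.* a) b
      point a b = cong₂ (λ s x → does (s ≟ n) ∧ (x ∧ inClass (+ 2 ℤ.* B) b))
                        (cong₂ _+_ (sym (sq-double a)) (ℕ.*-identityˡ (sq b))) (sym (inClass-double A a))

    quartic-term′ : (θ 4 (inClass B) *ₛ θ 1 (inClass (+ 2 ℤ.* A))) n ≡ count (λ _ d → not (odd d))
    quartic-term′ = begin
      (θ 4 (inClass B) *ₛ θ 1 (inClass (+ 2 ℤ.* A))) n
        ≡⟨ θ-product 4 1 (inClass B) (inClass (+ 2 ℤ.* A)) n ⟩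
      sumℤ n (λ a → sumℤ n (λ b → does (4 * sq a + 1 * sq b ≟ n) ∧ (inClass B a ∧ inClass (+ 2 ℤ.* A) b)))
        ≡⟨ sumℤ-cong n (λ a _ → sumℤ-cong n (λ b _ → point a b)) ⟩
      sumℤ n (λ a → sumℤ n (λ b → onCircle b (+ 2 ℤ.* a)))
        ≡⟨ sumℤ-comm n n (λ a b → onCircle b (+ 2 ℤ.* a)) ⟩
      sumℤ n (λ b → sumℤ n (λ a → onCircle b (+ 2 ℤ.* a)))
        ≡⟨ sumℤ-cong n (λ b _ → sumℤ-double-within n (onCircle-vanishesʳ b)) ⟩
      count (λ _ d → not (odd d)) ∎
      where
      open ≡-Reasoning
      point : ∀ a b → does (4 * sq a + 1 * sq b ≟ n) ∧ (inClass B a ∧ inClass (+ 2 ℤ.* A) b) ≡ onCircle b (+ 2 ℤ.* a)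
      point a b = cong₂ (λ s x → does (s ≟ n) ∧ x)
        (trans (cong₂ _+_ (sym (sq-double a)) (ℕ.*-identityˡ (sq b))) (ℕ.+-comm (sq (+ 2 ℤ.* a)) (sq b)))
        (trans (∧-comm (inClass B a) _) (cong (inClass (+ 2 ℤ.* A) b ∧_) (sym (inClass-double B a))))

    linear-term : (θ 1 (inClass (+ 2 ℤ.* A)) *ₛ θ 1 (inClass (+ 2 ℤ.* B))) n ≡ count (λ _ _ → true)
    linear-term = trans (θ-product 1 1 (inClass (+ 2 ℤ.* A)) (inClass (+ 2 ℤ.* B)) n)
      (sumℤ-cong n (λ a _ → sumℤ-cong n (λ b _ → cong (λ s → does (s ≟ n) ∧ (inClass (+ 2 ℤ.* A) a ∧ inClass (+ 2 ℤ.* B) b))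
        (cong₂ _+_ (ℕ.*-identityˡ (sq a)) (ℕ.*-identityˡ (sq b))))))

    n≤2n : n ≤ 2 * n
    n≤2n = ℕ.m≤m+n n (n + 0)

    n+k≤2n : ∀ {k} → k ≤ n → n + k ≤ 2 * n
    n+k≤2n k≤n = ℕ.+-monoʳ-≤ n (ℕ.≤-trans k≤n (ℕ.m≤m+n n 0))

    rotated-summand : ℤ → ℤ → Bool
    rotated-summand e f = does (2 * sq e + 2 * sq f ≟ n) ∧ (inClass (A ℤ.+ B) e ∧ inClass (A ℤ.- B) f)

    rotated-summand-vanishes : ∀ e → Vanishes n (rotated-summand e)
    rotated-summand-vanishes e f n<∣f∣ = cong (_∧ (inClass (A ℤ.+ B) e ∧ inClass (A ℤ.- B) f)) (does-≟-<
      (ℕ.<-≤-trans n<∣f∣ (ℕ.≤-trans (∣a∣≤sq f) (ℕ.≤-trans (ℕ.m≤n*m (sq f) 2) (ℕ.m≤n+m (2 * sq f) (2 * sq e))))))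

    -- Substitutes c = e + f.
    sum-rotated-summand : ∀ e → ∣ e ∣ ≤ n → sumℤ n (rotated-summand e) ≡ sumℤ n (λ c → onCircle c (e ℤ.+ e ℤ.- c))
    sum-rotated-summand e ∣e∣≤n = begin
      sumℤ n (rotated-summand e)         ≡⟨ sumℤ-widen (rotated-summand-vanishes e) n≤2n ⟨
      sumℤ (2 * n) (rotated-summand e)   ≡⟨ sumℤ-cong (2 * n) (λ f _ → rotate f) ⟩
      sumℤ (2 * n) (λ f → G (f ℤ.+ e))   ≡⟨ sumℤ-shift e G-vanishes (n+k≤2n ∣e∣≤n) ⟩
      sumℤ (2 * n) G                     ≡⟨ sumℤ-widen G-vanishes n≤2n ⟩
      sumℤ n G                           ∎
      where
      open ≡-Reasoning
      G : ℤ → Bool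
      G c = onCircle c (e ℤ.+ e ℤ.- c)
      G-vanishes : Vanishes n G
      G-vanishes c = onCircle-vanishesˡ (e ℤ.+ e ℤ.- c) c
      e-f≡e+e-[f+e] : ∀ e f → e ℤ.- f ≡ e ℤ.+ e ℤ.- (f ℤ.+ e)
      e-f≡e+e-[f+e] = solve-ℤ
      rotate : ∀ f → rotated-summand e f ≡ G (f ℤ.+ e)
      rotate f = trans (cong₂ (λ s x → does (s ≟ n) ∧ x) (sym (sq-rotate e f)) (inClass-rotate A B e f))
                       (cong₂ onCircle (ℤ.+-comm e f) (e-f≡e+e-[f+e] e f))

    -- Substitutes d = 2e − c, which ranges over the integers of the parity of c.
    sum-reflected : ∀ c → ∣ c ∣ ≤ n →
      sumℤ n (λ e → onCircle c (e ℤ.+ e ℤ.- c)) ≡ sumℤ n (λ d → not (odd (d ℤ.+ c)) ∧ onCircle c d)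
    sum-reflected c ∣c∣≤n = begin
      sumℤ n (λ e → onCircle c (e ℤ.+ e ℤ.- c))                ≡⟨ sumℤ-cong n (λ e _ → cong (onCircle c) (e+e-c≡2e-c e c)) ⟩
      sumℤ n (λ e → onCircle c (+ 2 ℤ.* e ℤ.- c))              ≡⟨ sumℤ-double n (λ x → onCircle c (x ℤ.- c)) ⟩
      sumℤ (2 * n) (λ x → not (odd x) ∧ onCircle c (x ℤ.- c))
        ≡⟨ sumℤ-cong (2 * n) (λ x _ → cong (λ y → not (odd y) ∧ onCircle c (x ℤ.- c)) (x≡[x-c]+c x c)) ⟩
      sumℤ (2 * n) (λ x → H (x ℤ.- c))                         ≡⟨ sumℤ-shift (ℤ.- c) H-vanishes (n+k≤2n ∣-c∣≤n) ⟩
      sumℤ (2 * n) H                                           ≡⟨ sumℤ-widen H-vanishes n≤2n ⟩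
      sumℤ n H                                                 ∎
      where
      open ≡-Reasoning
      H : ℤ → Bool
      H d = not (odd (d ℤ.+ c)) ∧ onCircle c d
      H-vanishes : Vanishes n H
      H-vanishes d n<∣d∣ = trans (cong (not (odd (d ℤ.+ c)) ∧_) (onCircle-vanishesʳ c d n<∣d∣)) (∧-zeroʳ _)
      ∣-c∣≤n : ∣ ℤ.- c ∣ ≤ n
      ∣-c∣≤n = subst (_≤ n) (sym (ℤ.∣-i∣≡∣i∣ c)) ∣c∣≤n
      e+e-c≡2e-c : ∀ e c → e ℤ.+ e ℤ.- c ≡ + 2 ℤ.* e ℤ.- c
      e+e-c≡2e-c = solve-ℤ
      x≡[x-c]+c : ∀ x c → x ≡ (x ℤ.- c) ℤ.+ c
      x≡[x-c]+c = solve-ℤ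

    rotated-term : (θ 2 (inClass (A ℤ.+ B)) *ₛ θ 2 (inClass (A ℤ.- B))) n ≡ count (λ c d → not (odd (d ℤ.+ c)))
    rotated-term = begin
      (θ 2 (inClass (A ℤ.+ B)) *ₛ θ 2 (inClass (A ℤ.- B))) n
        ≡⟨ θ-product 2 2 (inClass (A ℤ.+ B)) (inClass (A ℤ.- B)) n ⟩
      sumℤ n (λ e → sumℤ n (rotated-summand e))
        ≡⟨ sumℤ-cong n sum-rotated-summand ⟩
      sumℤ n (λ e → sumℤ n (λ c → onCircle c (e ℤ.+ e ℤ.- c)))
        ≡⟨ sumℤ-comm n n (λ e c → onCircle c (e ℤ.+ e ℤ.- c)) ⟩
      sumℤ n (λ c → sumℤ n (λ e → onCircle c (e ℤ.+ e ℤ.- c)))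
        ≡⟨ sumℤ-cong n sum-reflected ⟩
      count (λ c d → not (odd (d ℤ.+ c))) ∎
      where open ≡-Reasoning

    θ-relation : θ-combination A B n ≡ false
    θ-relation = begin
      θ-combination A B n
        ≡⟨ cong₂ _xor_ (cong₂ _xor_ (cong₂ _xor_ quartic-term quartic-term′) linear-term) rotated-term ⟩
      ((count w₁ xor count w₂) xor count w₃) xor count w₄
        ≡⟨ cong (λ x → (x xor count w₃) xor count w₄) (count-xor w₁ w₂) ⟩
      (count w₁₂ xor count w₃) xor count w₄     ≡⟨ cong (_xor count w₄) (count-xor w₁₂ w₃) ⟩
      count w₁₂₃ xor count w₄                   ≡⟨ count-xor w₁₂₃ w₄ ⟩
      count (λ c d → w₁₂₃ c d xor w₄ c d)       ≡⟨ count-false _ weights-cancel ⟩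
      false                                     ∎
      where
      open ≡-Reasoning
      w₁ w₂ w₃ w₄ : ℤ → ℤ → Bool
      w₁ c _ = not (odd c)
      w₂ _ d = not (odd d)
      w₃ _ _ = true
      w₄ c d = not (odd (d ℤ.+ c))
      w₁₂ w₁₂₃ : ℤ → ℤ → Bool
      w₁₂ c d = w₁ c d xor w₂ c d
      w₁₂₃ c d = w₁₂ c d xor w₃ c d
      cancel : ∀ a b → (((true xor a) xor (true xor b)) xor true) xor (true xor (b xor a)) ≡ false
      cancel = solve 2 (λ a b → (((con true :+ a) :+ (con true :+ b)) :+ con true) :+ (con true :+ (b :+ a)) := con false) refl
      weights-cancel : ∀ c d → w₁₂₃ c d xor w₄ c d ≡ false
      weights-cancel c d = trans (cong (λ o → ((w₁ c d xor w₂ c d) xor true) xor not o) (odd-+ d c)) (cancel (odd c) (odd d))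

  φ-R : ∀ r i j → 1 ≤ j → j < i → i ≤ m → ∀ n → φ m r (R m i j) n ≡ θ-combination (r ℤ.* + i) (r ℤ.* + j) n
  φ-R r i j 1≤j j<i i≤m n =
    cong₂ _xor_ (cong₂ _xor_ (cong₂ _xor_
      (*ₛ-cong (fourth-power i 1≤i i≤m) (φ-X-double j 1≤j j≤m) n)
      (*ₛ-cong (fourth-power j 1≤j j≤m) (φ-X-double i 1≤i i≤m) n))
      (*ₛ-cong (φ-X-double i 1≤i i≤m) (φ-X-double j 1≤j j≤m) n))
      (*ₛ-cong (θ-square-cong 1 _ (φ-X′ (i + j) (ℕ.≤-trans 1≤i (ℕ.m≤m+n i j)) i+j≤2m r*[i+j]))
               (θ-square-cong 1 _ (φ-X′ (i ∸ j) (ℕ.m<n⇒0<n∸m j<i) (ℕ.≤-trans (ℕ.m∸n≤m i j) (≤2m i≤m)) r*[i-j]))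
               n)
    where
    ≤2m : ∀ {k} → k ≤ m → k ≤ 2 * m
    ≤2m k≤m = ℕ.≤-trans k≤m (ℕ.m≤m+n m (m + 0))
    j≤i : j ≤ i
    j≤i = ℕ.<⇒≤ j<i
    1≤i : 1 ≤ i
    1≤i = ℕ.≤-trans 1≤j j≤i
    j≤m : j ≤ m
    j≤m = ℕ.≤-trans j≤i i≤m
    i+j≤2m : i + j ≤ 2 * m
    i+j≤2m = ℕ.≤-trans (ℕ.+-mono-≤ i≤m j≤m) (ℕ.≤-reflexive (cong (λ k → m + k) (sym (ℕ.+-identityʳ m))))
    φ-X′ : ∀ k → 1 ≤ k → k ≤ 2 * m → ∀ {C} → r ℤ.* + k ≡ C → ∀ t → φ m r (X m k) t ≡ θ 1 (inClass C) t
    φ-X′ k 1≤k k≤2m refl = φ-X r k 1≤k k≤2m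
    fourth-power : ∀ k → 1 ≤ k → k ≤ m → ∀ t → φ m r (X m k ^4) t ≡ θ 4 (inClass (r ℤ.* + k)) t
    fourth-power k 1≤k k≤m = θ-square-cong 2 _ (θ-square-cong 1 _ (φ-X r k 1≤k (≤2m k≤m)))
    φ-X-double : ∀ k → 1 ≤ k → k ≤ m → ∀ t → φ m r (X m (2 * k)) t ≡ θ 1 (inClass (+ 2 ℤ.* (r ℤ.* + k))) t
    φ-X-double k 1≤k k≤m = φ-X′ (2 * k) (ℕ.≤-trans 1≤k (ℕ.m≤m+n k (k + 0))) (ℕ.*-monoʳ-≤ 2 k≤m)
      (trans (cong (r ℤ.*_) (ℤ.pos-* 2 k)) (r*[2k] r (+ k)))
      where
      r*[2k] : ∀ r k → r ℤ.* (+ 2 ℤ.* k) ≡ + 2 ℤ.* (r ℤ.* k)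
      r*[2k] = solve-ℤ
    r*[i+j] : r ℤ.* + (i + j) ≡ r ℤ.* + i ℤ.+ r ℤ.* + j
    r*[i+j] = trans (cong (r ℤ.*_) (ℤ.pos-+ i j)) (ℤ.*-distribˡ-+ r (+ i) (+ j))
    r*[i-j] : r ℤ.* + (i ∸ j) ≡ r ℤ.* + i ℤ.- r ℤ.* + j
    r*[i-j] = trans (cong (r ℤ.*_) (sym (trans (ℤ.[+m]-[+n]≡m⊖n i j) (ℤ.⊖-≥ j≤i)))) (r*[a-b] r (+ i) (+ j))
      where
      r*[a-b] : ∀ r a b → r ℤ.* (a ℤ.- b) ≡ r ℤ.* a ℤ.- r ℤ.* b
      r*[a-b] = solve-ℤ

theorem3p8 : (m : ℕ) → 0 < m → (r : ℤ) → Coprime ∣ r ∣ (lOf m) →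
    (i j : ℕ) → 1 ≤ j → j < i → i ≤ m →
    (N : ℕ) → φ m r (R m i j) N ≡ false
theorem3p8 m _ r _ i j 1≤j j<i i≤m N =
  trans (φ-R r i j 1≤j j<i i≤m N) (θ-relation (r ℤ.* + i) (r ℤ.* + j) N)
  where open Residues m
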